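{- Take any integer $\ell \in [0, n-2]$. Then \begin{equation*} \sum_{\pi \in \mathrm{PPF}_n} q^{ \Delta_{\ell} f(\pi)}=(q+n-2)^{n-1}. \end{equation*}
   Context: A (classical) parking function of length $n$ is a sequence $\pi=(\pi_1,\dots,\pi_n)$ of positive integers whose increasing rearrangement $\lambda_1\le\cdots\le\lambda_n$ satisfies $\lambda_i\le i$. A parking function of length $n$ is prime if removing any instance of 1 yields a parking function of length $n-1$; $\mathrm{PPF}_n$ denotes the set of prime parking functions of length $n$. A tuple $\mathbf{x}=(x_1,\dots,x_n)$ has an $\ell$-forward difference at $i\in\{1,\dots,n-1\}$ if $x_{i+1}-x_i\equiv \ell \pmod{n-1}$, for $\ell\in\{0,1,\dots,n-2\}$; $\Delta_\ell f(\pi)$ denotes the number of $\ell$-forward differences of $\pi$. -}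

module Defs where

open import Data.Nat using (ℕ; zero; suc; _+_; _∸_; _^_; _≤_; _≤?_)
open import Data.Nat.Properties using (≤-decTotalOrder; _≟_)
import Data.Nat.Divisibility as ℕᵈ
open import Data.Integer using (ℤ; +_; _-_; ∣_∣)
open import Data.Integer.Divisibility using (_∣_)
open import Data.List using (List; []; _∷_; length; removeAt; filter; map; upTo; concatMap)
open import Data.Nat.ListAction using (sum)
open import Data.List.Relation.Unary.All using (All)
open import Data.List.Relation.Unary.All as All using ()
open import Data.List.Sort.InsertionSort ≤-decTotalOrder using (sort)
open import Data.Fin using (Fin; zero; suc)
open import Data.List using (lookup)
open import Data.Product using (_×_; _,_)
open import Data.Unit using (⊤; tt)
open import Relation.Nullary using (Dec; yes; no; _×-dec_; _→-dec_)
open import Relation.Binary.PropositionalEquality using (_≡_)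

BoundedFrom : ℕ → List ℕ → Set
BoundedFrom i []       = ⊤
BoundedFrom i (x ∷ xs) = (x ≤ i) × BoundedFrom (suc i) xs

boundedFrom? : ∀ i xs → Dec (BoundedFrom i xs)
boundedFrom? i []       = yes tt
boundedFrom? i (x ∷ xs) = (x ≤? i) ×-dec boundedFrom? (suc i) xs

IsParkingFunction : List ℕ → Set
IsParkingFunction π = All (1 ≤_) π × BoundedFrom 1 (sort π)

isParkingFunction? : ∀ π → Dec (IsParkingFunction π)
isParkingFunction? π = All.all? (1 ≤?_) π ×-dec boundedFrom? 1 (sort π)

allFin? : ∀ {k} {P : Fin k → Set} → ((j : Fin k) → Dec (P j)) → Dec ((j : Fin k) → P j)
allFin? {zero}  P? = yes (λ ())
allFin? {suc k} P? with P? zero | allFin? (λ j → P? (suc j))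
... | yes p | yes ps = yes (λ { zero → p ; (suc j) → ps j })
... | no ¬p | _      = no (λ f → ¬p (f zero))
... | yes _ | no ¬ps = no (λ f → ¬ps (λ j → f (suc j)))

IsPrimeParkingFunction : List ℕ → Set
IsPrimeParkingFunction π =
  IsParkingFunction π ×
  ((j : Fin (length π)) → lookup π j ≡ 1 → IsParkingFunction (removeAt π j))

isPrimeParkingFunction? : ∀ π → Dec (IsPrimeParkingFunction π)
isPrimeParkingFunction? π =
  isParkingFunction? π ×-dec
  allFin? (λ j → (lookup π j ≟ 1) →-dec isParkingFunction? (removeAt π j))

tuples : ℕ → ℕ → List (List ℕ)
tuples zero    m = [] ∷ []
tuples (suc k) m = concatMap (λ x → map (suc x ∷_) (tuples k m)) (upTo m)

-- PPF_n, enumerated as a list (every parking function of length n has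
-- entries in {1,...,n}, so filtering {1..n}^n captures all of them).
PPF : ℕ → List (List ℕ)
PPF n = filter isPrimeParkingFunction? (tuples n n)

IsForwardDiff : (m ℓ a b : ℕ) → Set
IsForwardDiff m ℓ a b = (+ m) ∣ ((+ b - + a) - + ℓ)

isForwardDiff? : ∀ m ℓ a b → Dec (IsForwardDiff m ℓ a b)
isForwardDiff? m ℓ a b = m ℕᵈ.∣? ∣ (+ b - + a) - + ℓ ∣

-- Number of i with x_{i+1} - x_i ≡ ℓ (mod m); `countFrom m ℓ a xs` counts
-- the forward differences of the tuple a ∷ xs.
countFrom : (m ℓ : ℕ) → ℕ → List ℕ → ℕ
countFrom m ℓ a []       = 0
countFrom m ℓ a (b ∷ xs) with isForwardDiff? m ℓ a b
... | yes _ = suc (countFrom m ℓ b xs)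
... | no  _ = countFrom m ℓ b xs

countForwardDiff : (m ℓ : ℕ) → List ℕ → ℕ
countForwardDiff m ℓ []       = 0
countForwardDiff m ℓ (a ∷ xs) = countFrom m ℓ a xs

Δf : (n ℓ : ℕ) → List ℕ → ℕ
Δf n ℓ π = countForwardDiff (n ∸ 1) ℓ π

ppfSum : (n ℓ q : ℕ) → ℕ
ppfSum n ℓ q = sum (map (λ π → q ^ Δf n ℓ π) (PPF n))

{-# OPTIONS --safe #-}
module Submission where

-- Put m = n − 1. A parking function of length n is prime iff, for 1 ≤ j ≤ m,
-- at least j + 1 of its entries are ≤ j; in particular its entries are ≤ m.
-- For a tuple x ∈ {1, …, m}ⁿ consider its m cyclic shifts x − c (mod m). The
-- shift by c is prime exactly when c is the last minimum on [0, m) of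
-- t ↦ #{i : xᵢ ≤ t} − t, so exactly one shift of every x is prime. Shifting
-- preserves all differences modulo m, hence Δ_ℓ, and therefore
--   m · Σ_{π ∈ PPF_n} q^{Δ_ℓ(π)} = Σ_{x ∈ {1,…,m}ⁿ} q^{Δ_ℓ(x)} = m (q + m − 1)^{n−1},
-- the last sum because after x₁ exactly one of the m values of each next
-- entry creates an ℓ-forward difference.

open import Defs
open import Data.Nat using (ℕ; zero; suc; _+_; _*_; _∸_; _^_; _≤_; _<_; _≤?_; _<?_; z≤n; s≤s)
open import Data.Nat.Properties
open import Data.Nat.ListAction using (sum)
open import Data.Nat.ListAction.Properties using (sum-++; sum-↭)
open import Data.Nat.Tactic.RingSolver using (solve-∀)
open import Algebra.Properties.CommutativeSemigroup +-commutativeSemigroup using (interchange; x∙yz≈y∙xz)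
open import Data.Empty using (⊥-elim)
open import Data.Fin using (Fin; zero; suc)
open import Data.List using (List; []; _∷_; length; map; filter; upTo; applyUpTo; concat; concatMap; removeAt; lookup)
open import Data.List.Properties using (map-∘; map-concatMap; map-applyUpTo; length-removeAt′)
open import Data.List.Relation.Unary.All as All using (All; []; _∷_)
open import Data.List.Relation.Unary.All.Properties using (All¬⇒¬Any)
open import Data.List.Relation.Unary.Any using (Any; here; there)
open import Data.List.Relation.Unary.Linked as Linked using (Linked)
open import Data.List.Relation.Unary.Linked.Properties using (Linked⇒All)
open import Data.List.Relation.Binary.Permutation.Propositional using (_↭_)
open import Data.List.Relation.Binary.Permutation.Propositional.Properties using (map⁺; ↭-length)
open import Data.List.Sort.InsertionSort ≤-decTotalOrder using (sort)
open import Data.List.Sort.InsertionSort.Properties ≤-decTotalOrder using (sort-↭; sort-↗)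
open import Data.Product using (_×_; _,_; ∃-syntax; proj₁)
open import Data.Sum using (inj₁; inj₂)
open import Data.Unit using (tt)
open import Function using (_∘_)
open import Function.Bundles using (_⇔_; mk⇔; Equivalence)
open import Function.Construct.Composition using (_⇔-∘_)
open import Function.Construct.Symmetry using (⇔-sym)
open import Relation.Binary.Definitions using (tri<; tri≈; tri>)
open import Relation.Binary.PropositionalEquality
open import Relation.Nullary using (Dec; yes; no; ¬_)

𝟙 : {A : Set} → Dec A → ℕ
𝟙 (yes _) = 1
𝟙 (no _)  = 0

𝟙-yes : {A : Set} (a? : Dec A) → A → 𝟙 a? ≡ 1
𝟙-yes (yes _) _ = refl
𝟙-yes (no ¬a) a = ⊥-elim (¬a a)

𝟙-no : {A : Set} (a? : Dec A) → ¬ A → 𝟙 a? ≡ 0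
𝟙-no (yes a) ¬a = ⊥-elim (¬a a)
𝟙-no (no _)  _  = refl

𝟙-cong : {A B : Set} (a? : Dec A) (b? : Dec B) → A ⇔ B → 𝟙 a? ≡ 𝟙 b?
𝟙-cong (yes _) (yes _) _   = refl
𝟙-cong (no _)  (no _)  _   = refl
𝟙-cong (yes a) (no ¬b) A⇔B = ⊥-elim (¬b (Equivalence.to A⇔B a))
𝟙-cong (no ¬a) (yes b) A⇔B = ⊥-elim (¬a (Equivalence.from A⇔B b))

𝟙≤1 : {A : Set} (a? : Dec A) → 𝟙 a? ≤ 1
𝟙≤1 (yes _) = s≤s z≤n
𝟙≤1 (no _)  = z≤n

-- Opaque so that ∑< (suc n) f is not unfolded during unification; otherwise the
-- summands of ∑-cong and friends could not be inferred when the bound is a successor.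
opaque
  ∑< : ℕ → (ℕ → ℕ) → ℕ
  ∑< zero    f = 0
  ∑< (suc n) f = f 0 + ∑< n (f ∘ suc)

  infixl 10 ∑<
  syntax ∑< n (λ i → e) = ∑[ i < n ] e

  ∑-cong : ∀ n {f g : ℕ → ℕ} → (∀ {i} → i < n → f i ≡ g i) → ∑< n f ≡ ∑< n g
  ∑-cong zero    f≗g = refl
  ∑-cong (suc n) f≗g = cong₂ _+_ (f≗g (s≤s z≤n)) (∑-cong n (f≗g ∘ s≤s))

  ∑-zero : ∀ n → ∑[ _ < n ] 0 ≡ 0
  ∑-zero zero    = refl
  ∑-zero (suc n) = ∑-zero n

  ∑-const : ∀ n c → ∑[ _ < n ] c ≡ n * c
  ∑-const zero    c = refl
  ∑-const (suc n) c = cong (c +_) (∑-const n c)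

  ∑-split : ∀ a b f → ∑< (a + b) f ≡ ∑< a f + ∑[ i < b ] f (a + i)
  ∑-split zero    b f = refl
  ∑-split (suc a) b f = trans (cong (f 0 +_) (∑-split a b (f ∘ suc))) (sym (+-assoc (f 0) _ _))

  ∑-distrib-+ : ∀ n f g → ∑[ i < n ] (f i + g i) ≡ ∑< n f + ∑< n g
  ∑-distrib-+ zero    f g = refl
  ∑-distrib-+ (suc n) f g = trans (cong (f 0 + g 0 +_) (∑-distrib-+ n (f ∘ suc) (g ∘ suc)))
                                  (interchange (f 0) (g 0) _ _)

  ∑-comm : ∀ n m (h : ℕ → ℕ → ℕ) → ∑[ i < n ] ∑[ j < m ] h i j ≡ ∑[ j < m ] ∑[ i < n ] h i j
  ∑-comm zero    m h = sym (∑-zero m)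
  ∑-comm (suc n) m h = trans (cong (∑< m (h 0) +_) (∑-comm n m (h ∘ suc)))
                             (sym (∑-distrib-+ m (h 0) _))

  *-distribˡ-∑ : ∀ n c f → c * ∑< n f ≡ ∑[ i < n ] (c * f i)
  *-distribˡ-∑ zero    c f = *-zeroʳ c
  *-distribˡ-∑ (suc n) c f = trans (*-distribˡ-+ c (f 0) _) (cong (c * f 0 +_) (*-distribˡ-∑ n c (f ∘ suc)))

  *-distribʳ-∑ : ∀ n c f → ∑< n f * c ≡ ∑[ i < n ] (f i * c)
  *-distribʳ-∑ zero    c f = refl
  *-distribʳ-∑ (suc n) c f = trans (*-distribʳ-+ c (f 0) _) (cong (f 0 * c +_) (*-distribʳ-∑ n c (f ∘ suc)))

  ∑-𝟙-unique : ∀ M {Q : ℕ → Set} (Q? : ∀ c → Dec (Q c)) {c₀} → c₀ < M → Q c₀ →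
               (∀ {c} → c < M → Q c → c ≡ c₀) → ∑[ c < M ] 𝟙 (Q? c) ≡ 1
  ∑-𝟙-unique (suc M) Q? {zero} _ Q0 unique =
    cong₂ _+_ (𝟙-yes (Q? 0) Q0)
              (trans (∑-cong M (λ c<M → 𝟙-no (Q? _) (λ Qc → 0≢1+n (sym (unique (s≤s c<M) Qc)))))
                     (∑-zero M))
  ∑-𝟙-unique (suc M) Q? {suc c₀} (s≤s c₀<M) Qc₀ unique =
    cong₂ _+_ (𝟙-no (Q? 0) (λ Q0 → 0≢1+n (unique (s≤s z≤n) Q0)))
              (∑-𝟙-unique M (Q? ∘ suc) c₀<M Qc₀ (λ c<M Qc → suc-injective (unique (s≤s c<M) Qc)))

  ∑-pow-𝟙-≟ : ∀ q k {ℓ} → ℓ ≤ k → ∑[ x < suc k ] (q ^ 𝟙 (x ≟ ℓ)) ≡ q + k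
  ∑-pow-𝟙-≟ q k       {zero}  _ = cong₂ _+_ (*-identityʳ q) (trans (∑-const k 1) (*-identityʳ k))
  ∑-pow-𝟙-≟ q (suc k) {suc ℓ} (s≤s ℓ≤k) = begin
    1 + ∑[ x < suc k ] (q ^ 𝟙 (suc x ≟ suc ℓ))
      ≡⟨ cong (1 +_) (∑-cong (suc k) (λ {x} _ →
           cong (q ^_) (𝟙-cong (suc x ≟ suc ℓ) (x ≟ ℓ) (mk⇔ suc-injective (cong suc))))) ⟩
    1 + ∑[ x < suc k ] (q ^ 𝟙 (x ≟ ℓ))          ≡⟨ cong (1 +_) (∑-pow-𝟙-≟ q k ℓ≤k) ⟩
    1 + (q + k)                               ≡⟨ +-suc q k ⟨
    q + suc k                                 ∎
    where open ≡-Reasoning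

  sum-map-upTo : ∀ n f → sum (map f (upTo n)) ≡ ∑< n f
  sum-map-upTo n f = trans (cong sum (map-applyUpTo (λ x → x) f n)) (sum-applyUpTo n f)
    where
    sum-applyUpTo : ∀ n f → sum (applyUpTo f n) ≡ ∑< n f
    sum-applyUpTo zero    f = refl
    sum-applyUpTo (suc n) f = cong (f 0 +_) (sum-applyUpTo n (f ∘ suc))

∑-truncate : ∀ {M N} f → M ≤ N → (∀ {i} → M ≤ i → i < N → f i ≡ 0) → ∑< N f ≡ ∑< M f
∑-truncate {M} {N} f M≤N tail≡0 = begin
  ∑< N f                                   ≡⟨ cong (λ n → ∑< n f) (m+[n∸m]≡n M≤N) ⟨
  ∑< (M + (N ∸ M)) f                       ≡⟨ ∑-split M (N ∸ M) f ⟩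
  ∑< M f + ∑[ i < N ∸ M ] f (M + i)        ≡⟨ cong (∑< M f +_) (∑-cong (N ∸ M) tail≡0′) ⟩
  ∑< M f + ∑[ i < N ∸ M ] 0                ≡⟨ cong (∑< M f +_) (∑-zero (N ∸ M)) ⟩
  ∑< M f + 0                               ≡⟨ +-identityʳ _ ⟩
  ∑< M f                                   ∎
  where
  open ≡-Reasoning
  tail≡0′ : ∀ {i} → i < N ∸ M → f (M + i) ≡ 0
  tail≡0′ {i} i<N∸M = tail≡0 (m≤m+n M i) (subst (M + i <_) (m+[n∸m]≡n M≤N) (+-monoʳ-< M i<N∸M))

sum-concat : ∀ xss → sum (concat xss) ≡ sum (map sum xss)
sum-concat []         = refl
sum-concat (xs ∷ xss) = trans (sum-++ xs (concat xss)) (cong (sum xs +_) (sum-concat xss))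

sum-map-filter : ∀ {A : Set} {P : A → Set} (P? : ∀ x → Dec (P x)) (w : A → ℕ) xs →
                 sum (map w (filter P? xs)) ≡ sum (map (λ x → 𝟙 (P? x) * w x) xs)
sum-map-filter P? w []       = refl
sum-map-filter P? w (x ∷ xs) with P? x
... | yes _ = cong₂ _+_ (sym (+-identityʳ (w x))) (sum-map-filter P? w xs)
... | no  _ = sum-map-filter P? w xs

_∈[1,_] : ℕ → ℕ → Set
v ∈[1, N ] = 1 ≤ v × v ≤ N

∑tuples : ℕ → ℕ → (List ℕ → ℕ) → ℕ
∑tuples zero    N f = f []
∑tuples (suc k) N f = ∑[ x < N ] ∑tuples k N (λ t → f (suc x ∷ t))

sum-map-tuples : ∀ k N f → sum (map f (tuples k N)) ≡ ∑tuples k N f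
sum-map-tuples zero    N f = +-identityʳ (f [])
sum-map-tuples (suc k) N f = begin
  sum (map f (concatMap g (upTo N)))                 ≡⟨ cong sum (map-concatMap f g (upTo N)) ⟩
  sum (concat (map (map f ∘ g) (upTo N)))            ≡⟨ sum-concat (map (map f ∘ g) (upTo N)) ⟩
  sum (map sum (map (map f ∘ g) (upTo N)))           ≡⟨ cong sum (map-∘ (upTo N)) ⟨
  sum (map (sum ∘ map f ∘ g) (upTo N))               ≡⟨ sum-map-upTo N _ ⟩
  ∑[ x < N ] sum (map f (g x))                       ≡⟨ ∑-cong N (λ {x} _ → summand x) ⟩
  ∑tuples (suc k) N f                                ∎
  where
  open ≡-Reasoning
  g : ℕ → List (List ℕ)
  g x = map (suc x ∷_) (tuples k N)
  summand : ∀ x → sum (map f (g x)) ≡ ∑tuples k N (λ t → f (suc x ∷ t))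
  summand x = trans (cong sum (sym (map-∘ (tuples k N)))) (sum-map-tuples k N (λ t → f (suc x ∷ t)))

∑tuples-cong : ∀ k N {f g : List ℕ → ℕ} →
               (∀ {t} → length t ≡ k → All (_∈[1, N ]) t → f t ≡ g t) →
               ∑tuples k N f ≡ ∑tuples k N g
∑tuples-cong zero    N f≗g = f≗g refl []
∑tuples-cong (suc k) N f≗g = ∑-cong N λ x<N →
  ∑tuples-cong k N (λ |t|≡k t∈ → f≗g (cong suc |t|≡k) ((s≤s z≤n , x<N) ∷ t∈))

∑tuples-zero : ∀ k N → ∑tuples k N (λ _ → 0) ≡ 0
∑tuples-zero zero    N = refl
∑tuples-zero (suc k) N = trans (∑-cong N (λ _ → ∑tuples-zero k N)) (∑-zero N)

∑tuples-truncate : ∀ k {M N} f → M ≤ N → (∀ {t} → length t ≡ k → Any (M <_) t → f t ≡ 0) →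
                   ∑tuples k N f ≡ ∑tuples k M f
∑tuples-truncate zero    f M≤N large⇒0 = refl
∑tuples-truncate (suc k) {M} {N} f M≤N large⇒0 = trans
  (∑-truncate _ M≤N (λ M≤x _ →
     trans (∑tuples-cong k N (λ |t|≡k _ → large⇒0 (cong suc |t|≡k) (here (s≤s M≤x))))
           (∑tuples-zero k N)))
  (∑-cong M (λ _ → ∑tuples-truncate k _ M≤N (λ |t|≡k large → large⇒0 (cong suc |t|≡k) (there large))))

∑tuples-∑ : ∀ k N M (h : ℕ → List ℕ → ℕ) →
            ∑tuples k N (λ t → ∑[ c < M ] h c t) ≡ ∑[ c < M ] ∑tuples k N (h c)
∑tuples-∑ zero    N M h = refl
∑tuples-∑ (suc k) N M h = trans (∑-cong N (λ {x} _ → ∑tuples-∑ k N M (λ c t → h c (suc x ∷ t))))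
                                (∑-comm N M (λ x c → ∑tuples k N (λ t → h c (suc x ∷ t))))

*-distribˡ-∑tuples : ∀ k N a f → a * ∑tuples k N f ≡ ∑tuples k N (λ t → a * f t)
*-distribˡ-∑tuples zero    N a f = refl
*-distribˡ-∑tuples (suc k) N a f = trans (*-distribˡ-∑ N a _)
  (∑-cong N (λ {x} _ → *-distribˡ-∑tuples k N a (λ t → f (suc x ∷ t))))

-- Cyclic shifts and forward differences

-- v − c modulo m, represented in {1, …, m} like the tuple entries.
rotate : ℕ → ℕ → ℕ → ℕ
rotate m c v with c <? v
... | yes _ = v ∸ c
... | no  _ = v + m ∸ c

rotate-> : ∀ m {c v} → c < v → rotate m c v ≡ v ∸ c
rotate-> m {c} {v} c<v with c <? v
... | yes _   = refl
... | no  c≮v = ⊥-elim (c≮v c<v)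

rotate-≤ : ∀ m {c v} → v ≤ c → rotate m c v ≡ v + m ∸ c
rotate-≤ m {c} {v} v≤c with c <? v
... | yes c<v = ⊥-elim (<⇒≱ c<v v≤c)
... | no  _   = refl

rotate-+-> : ∀ m {c v} → c < v → rotate m c v + c ≡ v
rotate-+-> m {c} c<v = trans (cong (_+ c) (rotate-> m c<v)) (m∸n+n≡m (<⇒≤ c<v))

rotate-+-≤ : ∀ {m c v} → c ≤ m → v ≤ c → rotate m c v + c ≡ v + m
rotate-+-≤ {m} {c} {v} c≤m v≤c = trans (cong (_+ c) (rotate-≤ m v≤c)) (m∸n+n≡m (≤-trans c≤m (m≤n+m m v)))

rotate-≡-mod : ∀ m {c} v → c ≤ m → ∃[ e ] rotate m c v + c ≡ v + m * e
rotate-≡-mod m {c} v c≤m with v ≤? c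
... | no  v≰c = 0 , trans (rotate-+-> m (≰⇒> v≰c)) (sym (trans (cong (v +_) (*-zeroʳ m)) (+-identityʳ v)))
... | yes v≤c = 1 , trans (rotate-+-≤ c≤m v≤c) (cong (v +_) (sym (*-identityʳ m)))

∑-rotate : ∀ {m c} (h : ℕ → ℕ) → c ≤ m → ∑[ x < m ] h (rotate m c (suc x)) ≡ ∑[ x < m ] h (suc x)
∑-rotate {m} {c} h c≤m = begin
  ∑[ x < m ] h (rotate m c (suc x))
    ≡⟨ cong (λ n → ∑[ x < n ] h (rotate m c (suc x))) c+r≡m ⟨
  ∑[ x < c + r ] h (rotate m c (suc x))                            ≡⟨ ∑-split c r _ ⟩
  ∑[ x < c ] h (rotate m c (suc x)) + ∑[ i < r ] h (rotate m c (suc (c + i)))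
      ≡⟨ cong₂ _+_ (∑-cong c (λ x<c → cong h (wrapped x<c))) (∑-cong r (λ {i} _ → cong h (shifted i))) ⟩
  ∑[ x < c ] h (suc (r + x)) + ∑[ i < r ] h (suc i)                 ≡⟨ +-comm (∑[ x < c ] h (suc (r + x))) _ ⟩
  ∑[ i < r ] h (suc i) + ∑[ x < c ] h (suc (r + x))                 ≡⟨ ∑-split r c (h ∘ suc) ⟨
  ∑[ x < r + c ] h (suc x)
    ≡⟨ cong (λ n → ∑[ x < n ] h (suc x)) (trans (+-comm r c) c+r≡m) ⟩
  ∑[ x < m ] h (suc x)                                              ∎
  where
  open ≡-Reasoning
  r = m ∸ c
  c+r≡m : c + r ≡ m
  c+r≡m = m+[n∸m]≡n c≤m
  wrapped : ∀ {x} → x < c → rotate m c (suc x) ≡ suc (r + x)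
  wrapped {x} x<c = begin
    rotate m c (suc x)   ≡⟨ rotate-≤ m x<c ⟩
    suc x + m ∸ c        ≡⟨ cong (λ n → suc x + n ∸ c) c+r≡m ⟨
    suc x + (c + r) ∸ c  ≡⟨ cong (_∸ c) (regroup x c r) ⟩
    c + suc (r + x) ∸ c  ≡⟨ m+n∸m≡n c _ ⟩
    suc (r + x)          ∎
    where
    regroup : ∀ x c r → suc x + (c + r) ≡ c + suc (r + x)
    regroup = solve-∀
  shifted : ∀ i → rotate m c (suc (c + i)) ≡ suc i
  shifted i = trans (rotate-> m (s≤s (m≤m+n c i))) (trans (cong (_∸ c) (sym (+-suc c i))) (m+n∸m≡n c (suc i)))

∑tuples-rotate : ∀ k {m c} (f : List ℕ → ℕ) → c ≤ m →
                 ∑tuples k m (f ∘ map (rotate m c)) ≡ ∑tuples k m f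
∑tuples-rotate zero    f c≤m = refl
∑tuples-rotate (suc k) {m} {c} f c≤m = trans
  (∑-cong m (λ {x} _ → ∑tuples-rotate k (λ t → f (rotate m c (suc x) ∷ t)) c≤m))
  (∑-rotate (λ v → ∑tuples k m (λ t → f (v ∷ t))) c≤m)

-- Integer notation stays local: its +_ would clash with sections such as (n +_).
module _ where
  open import Data.Integer using (ℤ; +_; _⊖_) renaming (_+_ to _+ℤ_; _*_ to _*ℤ_; _-_ to _-ℤ_)
  import Data.Integer as ℤ
  import Data.Integer.Properties as ℤ
  import Data.Integer.Divisibility.Signed as ℤ
  import Data.Integer.Tactic.RingSolver as ℤ-Ring
  open import Data.Nat using (_⊔_)
  import Data.Nat.Divisibility as ℕ

  IsForwardDiff-shift : ∀ {m ℓ a b a′ b′} c i j → a′ + c ≡ a + m * i → b′ + c ≡ b + m * j →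
                        IsForwardDiff m ℓ a b ⇔ IsForwardDiff m ℓ a′ b′
  IsForwardDiff-shift {m} {ℓ} {a} {b} {a′} {b′} c i j a′≡ b′≡ = mk⇔
    (λ m∣D → ℤ.∣⇒∣ᵤ (subst (+ m ℤ.∣_) (sym D′≡D+mk) (ℤ.∣m∣n⇒∣m+n (ℤ.∣ᵤ⇒∣ {i = D} m∣D) m∣mk)))
    (λ m∣D′ → ℤ.∣⇒∣ᵤ {i = D}
                (ℤ.∣m+n∣n⇒∣m {m = D} (subst (+ m ℤ.∣_) D′≡D+mk (ℤ.∣ᵤ⇒∣ m∣D′)) m∣mk))
    where
    D D′ mk : ℤ
    D  = (+ b -ℤ + a) -ℤ + ℓ
    D′ = (+ b′ -ℤ + a′) -ℤ + ℓ
    mk = + m *ℤ (+ j -ℤ + i)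
    m∣mk : + m ℤ.∣ mk
    m∣mk = ℤ.∣m⇒∣m*n (+ j -ℤ + i) ℤ.∣-refl
    lift : ∀ {x′ x} e → x′ + c ≡ x + m * e → + x′ ≡ (+ x +ℤ + m *ℤ + e) -ℤ + c
    lift {x′} {x} e eq = begin
      + x′                          ≡⟨ add-sub (+ x′) (+ c) ⟩
      (+ x′ +ℤ + c) -ℤ + c          ≡⟨ cong (_-ℤ + c) (ℤ.pos-+ x′ c) ⟨
      + (x′ + c) -ℤ + c             ≡⟨ cong (λ y → + y -ℤ + c) eq ⟩
      + (x + m * e) -ℤ + c          ≡⟨ cong (_-ℤ + c) (trans (ℤ.pos-+ x (m * e)) (cong (+ x +ℤ_) (ℤ.pos-* m e))) ⟩
      (+ x +ℤ + m *ℤ + e) -ℤ + c    ∎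
      where
      open ≡-Reasoning
      add-sub : ∀ X C → X ≡ (X +ℤ C) -ℤ C
      add-sub = ℤ-Ring.solve-∀
    D′≡D+mk : D′ ≡ D +ℤ mk
    D′≡D+mk = trans (cong₂ (λ x y → (x -ℤ y) -ℤ + ℓ) (lift j b′≡) (lift i a′≡))
                    (difference (+ a) (+ b) (+ ℓ) (+ m) (+ i) (+ j) (+ c))
      where
      difference : ∀ A B L M I J C →
                   (((B +ℤ M *ℤ J) -ℤ C) -ℤ ((A +ℤ M *ℤ I) -ℤ C)) -ℤ L ≡ ((B -ℤ A) -ℤ L) +ℤ M *ℤ (J -ℤ I)
      difference = ℤ-Ring.solve-∀

  IsForwardDiff-+ : ∀ {m ℓ x} a → ℓ < m → x < m → IsForwardDiff m ℓ a (a + x) ⇔ x ≡ ℓ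
  IsForwardDiff-+ {m} {ℓ} {x} a ℓ<m x<m = mk⇔
    (λ m∣D → ℤ.+-injective (ℤ.i-j≡0⇒i≡j (+ x) (+ ℓ) (trans (sym D≡) (ℤ.∣i∣≡0⇒i≡0 (small m∣D)))))
    (λ { refl → subst (λ d → m ℕ.∣ ℤ.∣ d ∣) (sym (trans D≡ (ℤ.+-inverseʳ (+ x)))) (m ℕ.∣0) })
    where
    D : ℤ
    D = (+ (a + x) -ℤ + a) -ℤ + ℓ
    D≡ : D ≡ + x -ℤ + ℓ
    D≡ = trans (cong (λ y → (y -ℤ + a) -ℤ + ℓ) (ℤ.pos-+ a x)) (cancel (+ a) (+ x) (+ ℓ))
      where
      cancel : ∀ A X L → ((A +ℤ X) -ℤ A) -ℤ L ≡ X -ℤ L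
      cancel = ℤ-Ring.solve-∀
    ∣D∣<m : ℤ.∣ D ∣ < m
    ∣D∣<m = begin-strict
      ℤ.∣ D ∣          ≡⟨ cong ℤ.∣_∣ (trans D≡ (ℤ.m-n≡m⊖n x ℓ)) ⟩
      ℤ.∣ x ⊖ ℓ ∣      ≤⟨ ℤ.∣m⊝n∣≤m⊔n x ℓ ⟩
      x ⊔ ℓ            <⟨ ⊔-lub x<m ℓ<m ⟩
      m                ∎
      where open ≤-Reasoning
    small : m ℕ.∣ ℤ.∣ D ∣ → ℤ.∣ D ∣ ≡ 0
    small m∣D with ℤ.∣ D ∣ in eq
    ... | zero  = refl
    ... | suc d = ⊥-elim (<⇒≱ (subst (_< m) eq ∣D∣<m) (ℕ.∣⇒≤ m∣D))

IsForwardDiff-rotate : ∀ {m ℓ c} a b → c ≤ m →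
                       IsForwardDiff m ℓ a b ⇔ IsForwardDiff m ℓ (rotate m c a) (rotate m c b)
IsForwardDiff-rotate {m} {c = c} a b c≤m =
  let i , a≡ = rotate-≡-mod m a c≤m
      j , b≡ = rotate-≡-mod m b c≤m
  in IsForwardDiff-shift c i j a≡ b≡

countFrom-∷ : ∀ m ℓ a b t → countFrom m ℓ a (b ∷ t) ≡ 𝟙 (isForwardDiff? m ℓ a b) + countFrom m ℓ b t
countFrom-∷ m ℓ a b t with isForwardDiff? m ℓ a b
... | yes _ = refl
... | no  _ = refl

countFrom-rotate : ∀ {m ℓ c} a t → c ≤ m →
                   countFrom m ℓ (rotate m c a) (map (rotate m c) t) ≡ countFrom m ℓ a t
countFrom-rotate a []      c≤m = refl
countFrom-rotate {m} {ℓ} {c} a (b ∷ t) c≤m = begin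
  countFrom m ℓ (rotate m c a) (map (rotate m c) (b ∷ t))
    ≡⟨ countFrom-∷ m ℓ _ _ _ ⟩
  𝟙 (isForwardDiff? m ℓ (rotate m c a) (rotate m c b)) + countFrom m ℓ (rotate m c b) (map (rotate m c) t)
    ≡⟨ cong₂ _+_ (𝟙-cong _ _ (⇔-sym (IsForwardDiff-rotate a b c≤m))) (countFrom-rotate b t c≤m) ⟩
  𝟙 (isForwardDiff? m ℓ a b) + countFrom m ℓ b t
    ≡⟨ countFrom-∷ m ℓ a b t ⟨
  countFrom m ℓ a (b ∷ t) ∎
  where open ≡-Reasoning

countForwardDiff-rotate : ∀ {m ℓ c} t → c ≤ m → countForwardDiff m ℓ (map (rotate m c) t) ≡ countForwardDiff m ℓ t
countForwardDiff-rotate []      c≤m = refl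
countForwardDiff-rotate (a ∷ t) c≤m = countFrom-rotate a t c≤m

∑-pow-𝟙-forwardDiff : ∀ q k {ℓ} a → ℓ ≤ k → a ∈[1, suc k ] →
                      ∑[ x < suc k ] (q ^ 𝟙 (isForwardDiff? (suc k) ℓ a (suc x))) ≡ q + k
∑-pow-𝟙-forwardDiff q k {ℓ} (suc a) ℓ≤k (_ , a<m) = begin
  ∑[ x < m ] weight (suc a) (suc x)
    ≡⟨ ∑-cong m (λ {x} _ → weight-cong (suc a) (suc x) (rotate m a (suc a)) (rotate m a (suc x))
                                        (IsForwardDiff-rotate (suc a) (suc x) a≤m)) ⟩
  ∑[ x < m ] weight (rotate m a (suc a)) (rotate m a (suc x))
    ≡⟨ ∑-cong m (λ {x} _ → cong (λ v → weight v (rotate m a (suc x))) rotate-a-to-1) ⟩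
  ∑[ x < m ] weight 1 (rotate m a (suc x))
    ≡⟨ ∑-rotate (weight 1) a≤m ⟩
  ∑[ x < m ] weight 1 (suc x)
    ≡⟨ ∑-cong m (λ {x} x<m → cong (q ^_) (𝟙-cong (isForwardDiff? m ℓ 1 (suc x)) (x ≟ ℓ)
                                                  (IsForwardDiff-+ 1 (s≤s ℓ≤k) x<m))) ⟩
  ∑[ x < m ] (q ^ 𝟙 (x ≟ ℓ))
    ≡⟨ ∑-pow-𝟙-≟ q k ℓ≤k ⟩
  q + k ∎
  where
  open ≡-Reasoning
  m = suc k
  weight : ℕ → ℕ → ℕ
  weight u v = q ^ 𝟙 (isForwardDiff? m ℓ u v)
  weight-cong : ∀ u v u′ v′ → IsForwardDiff m ℓ u v ⇔ IsForwardDiff m ℓ u′ v′ → weight u v ≡ weight u′ v′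
  weight-cong u v u′ v′ = cong (q ^_) ∘ 𝟙-cong (isForwardDiff? m ℓ u v) (isForwardDiff? m ℓ u′ v′)
  a≤m : a ≤ m
  a≤m = <⇒≤ a<m
  rotate-a-to-1 : rotate m a (suc a) ≡ 1
  rotate-a-to-1 = trans (rotate-> m (n<1+n a)) (m+n∸n≡m 1 a)

∑tuples-pow-countFrom : ∀ q k j {ℓ} a → ℓ ≤ k → a ∈[1, suc k ] →
                        ∑tuples j (suc k) (λ t → q ^ countFrom (suc k) ℓ a t) ≡ (q + k) ^ j
∑tuples-pow-countFrom q k zero    a ℓ≤k a∈ = refl
∑tuples-pow-countFrom q k (suc j) {ℓ} a ℓ≤k a∈ = begin
  ∑[ x < m ] ∑tuples j m (λ t → q ^ countFrom m ℓ a (suc x ∷ t))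
    ≡⟨ ∑-cong m (λ {x} _ → ∑tuples-cong j m (λ {t} _ _ → split x t)) ⟩
  ∑[ x < m ] ∑tuples j m (λ t → φ x * q ^ countFrom m ℓ (suc x) t)
    ≡⟨ ∑-cong m (λ {x} _ → *-distribˡ-∑tuples j m (φ x) (λ t → q ^ countFrom m ℓ (suc x) t)) ⟨
  ∑[ x < m ] (φ x * ∑tuples j m (λ t → q ^ countFrom m ℓ (suc x) t))
    ≡⟨ ∑-cong m (λ {x} x<m → cong (φ x *_) (∑tuples-pow-countFrom q k j (suc _) ℓ≤k (s≤s z≤n , x<m))) ⟩
  ∑[ x < m ] (φ x * (q + k) ^ j)
    ≡⟨ *-distribʳ-∑ m ((q + k) ^ j) φ ⟨
  ∑[ x < m ] φ x * (q + k) ^ j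
    ≡⟨ cong (_* (q + k) ^ j) (∑-pow-𝟙-forwardDiff q k a ℓ≤k a∈) ⟩
  (q + k) ^ suc j ∎
  where
  open ≡-Reasoning
  m = suc k
  φ : ℕ → ℕ
  φ x = q ^ 𝟙 (isForwardDiff? m ℓ a (suc x))
  split : ∀ x t → q ^ countFrom m ℓ a (suc x ∷ t) ≡ φ x * q ^ countFrom m ℓ (suc x) t
  split x t = trans (cong (q ^_) (countFrom-∷ m ℓ a (suc x) t))
                    (^-distribˡ-+-* q (𝟙 (isForwardDiff? m ℓ a (suc x))) (countFrom m ℓ (suc x) t))

∑tuples-pow-countForwardDiff : ∀ q k j {ℓ} → ℓ ≤ k →
                               ∑tuples (suc j) (suc k) (λ t → q ^ countForwardDiff (suc k) ℓ t) ≡ suc k * (q + k) ^ j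
∑tuples-pow-countForwardDiff q k j ℓ≤k =
  trans (∑-cong (suc k) (λ x<m → ∑tuples-pow-countFrom q k j (suc _) ℓ≤k (s≤s z≤n , x<m)))
        (∑-const (suc k) _)

-- Parking functions via counts of small entries

count≤ : ℕ → List ℕ → ℕ
count≤ k xs = sum (map (λ v → 𝟙 (v ≤? k)) xs)

count≤-≤-length : ∀ k xs → count≤ k xs ≤ length xs
count≤-≤-length k []       = z≤n
count≤-≤-length k (v ∷ xs) = +-mono-≤ (𝟙≤1 (v ≤? k)) (count≤-≤-length k xs)

count≤-mono : ∀ {k k′} xs → k ≤ k′ → count≤ k xs ≤ count≤ k′ xs
count≤-mono []                 k≤k′ = z≤n
count≤-mono {k} {k′} (v ∷ xs) k≤k′ = +-mono-≤ indicator-mono (count≤-mono xs k≤k′)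
  where
  indicator-mono : 𝟙 (v ≤? k) ≤ 𝟙 (v ≤? k′)
  indicator-mono with v ≤? k
  ... | yes v≤k = ≤-reflexive (sym (𝟙-yes (v ≤? k′) (≤-trans v≤k k≤k′)))
  ... | no  _   = z≤n

length≤count≤⇒All≤ : ∀ k xs → length xs ≤ count≤ k xs → All (_≤ k) xs
length≤count≤⇒All≤ k []       _ = []
length≤count≤⇒All≤ k (v ∷ xs) |v∷xs|≤count with v ≤? k
... | yes v≤k = v≤k ∷ length≤count≤⇒All≤ k xs (≤-pred |v∷xs|≤count)
... | no  _   = ⊥-elim (<⇒≱ |v∷xs|≤count (count≤-≤-length k xs))

All>⇒count≤≡0 : ∀ k {xs} → All (k <_) xs → count≤ k xs ≡ 0
All>⇒count≤≡0 k []                   = refl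
All>⇒count≤≡0 k {v ∷ _} (k<v ∷ k<xs) = cong₂ _+_ (𝟙-no (v ≤? k) (<⇒≱ k<v)) (All>⇒count≤≡0 k k<xs)

count≤-removeAt : ∀ k xs j → count≤ k xs ≡ 𝟙 (lookup xs j ≤? k) + count≤ k (removeAt xs j)
count≤-removeAt k (v ∷ xs) zero    = refl
count≤-removeAt k (v ∷ xs) (suc j) = trans (cong (𝟙 (v ≤? k) +_) (count≤-removeAt k xs j))
                                           (x∙yz≈y∙xz (𝟙 (v ≤? k)) (𝟙 (lookup xs j ≤? k)) (count≤ k (removeAt xs j)))

count≤-↭ : ∀ k {xs ys} → xs ↭ ys → count≤ k xs ≡ count≤ k ys
count≤-↭ k xs↭ys = sum-↭ (map⁺ _ xs↭ys)

count≤-removeAt-1 : ∀ k xs j → lookup xs j ≡ 1 → count≤ (suc k) xs ≡ suc (count≤ (suc k) (removeAt xs j))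
count≤-removeAt-1 k xs j xⱼ≡1 = trans (count≤-removeAt (suc k) xs j)
  (cong (_+ count≤ (suc k) (removeAt xs j)) (𝟙-yes (lookup xs j ≤? suc k) (subst (_≤ suc k) (sym xⱼ≡1) (s≤s z≤n))))

count≤1⇒lookup≡1 : ∀ xs → All (1 ≤_) xs → 1 ≤ count≤ 1 xs → ∃[ j ] lookup xs j ≡ 1
count≤1⇒lookup≡1 (v ∷ xs) (1≤v ∷ 1≤xs) 1≤count with v ≤? 1
... | yes v≤1 = zero , ≤-antisym v≤1 1≤v
... | no  _   = let j , xⱼ≡1 = count≤1⇒lookup≡1 xs 1≤xs 1≤count in suc j , xⱼ≡1

All-removeAt : ∀ {P : ℕ → Set} xs j → All P xs → All P (removeAt xs j)
All-removeAt (v ∷ xs) zero    (_ ∷ pxs)  = pxs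
All-removeAt (v ∷ xs) (suc j) (pv ∷ pxs) = pv ∷ All-removeAt xs j pxs

BoundedFrom⇒count≤ : ∀ i s → BoundedFrom i s → ∀ {j} → j < length s → suc j ≤ count≤ (i + j) s
BoundedFrom⇒count≤ i (x ∷ s) (x≤i , s-bounded) {j} j<len = begin
  suc j                    ≤⟨ s≤s (tail-count j j<len) ⟩
  suc (count≤ (i + j) s)   ≡⟨ cong (_+ count≤ (i + j) s) (𝟙-yes (x ≤? i + j) (≤-trans x≤i (m≤m+n i j))) ⟨
  count≤ (i + j) (x ∷ s)   ∎
  where
  open ≤-Reasoning
  tail-count : ∀ j → j < suc (length s) → j ≤ count≤ (i + j) s
  tail-count zero    _           = z≤n
  tail-count (suc j) (s≤s j<len) = subst (λ n → suc j ≤ count≤ n s) (sym (+-suc i j))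
                                         (BoundedFrom⇒count≤ (suc i) s s-bounded j<len)

count≤⇒BoundedFrom : ∀ i s → Linked _≤_ s → (∀ {j} → j < length s → suc j ≤ count≤ (i + j) s) →
                     BoundedFrom i s
count≤⇒BoundedFrom i []      _      _      = tt
count≤⇒BoundedFrom i (x ∷ s) sorted counts with x ≤? i
... | yes x≤i = x≤i , count≤⇒BoundedFrom (suc i) s (Linked.tail sorted) tail-counts
  where
  tail-counts : ∀ {j} → j < length s → suc j ≤ count≤ (suc i + j) s
  tail-counts {j} j<len = ≤-pred (begin
    suc (suc j)                ≤⟨ counts (s≤s j<len) ⟩
    count≤ (i + suc j) (x ∷ s) ≡⟨ cong₂ _+_ (𝟙-yes (x ≤? i + suc j) (≤-trans x≤i (m≤m+n i (suc j))))
                                            (cong (λ n → count≤ n s) (+-suc i j)) ⟩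
    suc (count≤ (suc i + j) s) ∎)
    where open ≤-Reasoning
... | no  x≰i = ⊥-elim (<⇒≱ (counts (s≤s z≤n)) (≤-reflexive none≤i))
  where
  none≤i : count≤ (i + 0) (x ∷ s) ≡ 0
  none≤i = trans (cong (λ n → count≤ n (x ∷ s)) (+-identityʳ i))
                 (All>⇒count≤≡0 i (All.map (<-≤-trans (≰⇒> x≰i)) (Linked⇒All ≤-trans ≤-refl sorted)))

ParkingCounts : List ℕ → Set
ParkingCounts π = ∀ {j} → j < length π → suc j ≤ count≤ (suc j) π

IsParkingFunction⇔ : ∀ π → IsParkingFunction π ⇔ (All (1 ≤_) π × ParkingCounts π)
IsParkingFunction⇔ π = mk⇔
  (λ (positive , bounded) → positive , λ {j} j<len →
     subst (suc j ≤_) (count≤-↭ (suc j) (sort-↭ π))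
           (BoundedFrom⇒count≤ 1 (sort π) bounded (subst (j <_) (sym |sort|) j<len)))
  (λ (positive , counts) → positive , count≤⇒BoundedFrom 1 (sort π) (sort-↗ π) λ {j} j<len →
     subst (suc j ≤_) (sym (count≤-↭ (suc j) (sort-↭ π))) (counts (subst (j <_) |sort| j<len)))
  where
  |sort| : length (sort π) ≡ length π
  |sort| = ↭-length (sort-↭ π)

PrimeCounts : ℕ → List ℕ → Set
PrimeCounts m x = ∀ {j} → j < m → 2 + j ≤ count≤ (suc j) x

primeCounts? : ∀ m x → Dec (PrimeCounts m x)
primeCounts? m x = allUpTo? (λ j → 2 + j ≤? count≤ (suc j) x) m

length-removeAt-pred : ∀ {m} (xs : List ℕ) j → length xs ≡ suc m → length (removeAt xs j) ≡ m
length-removeAt-pred xs j |xs|≡1+m = suc-injective (trans (sym (length-removeAt′ xs j)) |xs|≡1+m)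

IsPrimeParkingFunction⇒PrimeCounts : ∀ m x → length x ≡ suc m → IsPrimeParkingFunction x → PrimeCounts m x
IsPrimeParkingFunction⇒PrimeCounts m x |x|≡1+m (parking , prime) {j} j<m =
  let x-positive , x-counts = Equivalence.to (IsParkingFunction⇔ x) parking
      j₀ , xⱼ₀≡1 = count≤1⇒lookup≡1 x x-positive (x-counts (subst (0 <_) (sym |x|≡1+m) (s≤s z≤n)))
      _ , removed-counts = Equivalence.to (IsParkingFunction⇔ (removeAt x j₀)) (prime j₀ xⱼ₀≡1)
  in subst (2 + j ≤_) (sym (count≤-removeAt-1 j x j₀ xⱼ₀≡1))
           (s≤s (removed-counts (subst (j <_) (sym (length-removeAt-pred x j₀ |x|≡1+m)) j<m)))

PrimeCounts⇒IsPrimeParkingFunction : ∀ k x → length x ≡ suc (suc k) → All (1 ≤_) x →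
                                     PrimeCounts (suc k) x → IsPrimeParkingFunction x
PrimeCounts⇒IsPrimeParkingFunction k x |x|≡2+k positive counts =
  Equivalence.from (IsParkingFunction⇔ x) (positive , parking-counts) , removal-parks
  where
  parking-counts : ParkingCounts x
  parking-counts {j} j<len with m<1+n⇒m<n∨m≡n (subst (j <_) |x|≡2+k j<len)
  ... | inj₁ j<1+k  = ≤-trans (n≤1+n (suc j)) (counts j<1+k)
  ... | inj₂ refl   = ≤-trans (counts ≤-refl) (count≤-mono x (n≤1+n (suc k)))
  removal-parks : (j₀ : Fin (length x)) → lookup x j₀ ≡ 1 → IsParkingFunction (removeAt x j₀)
  removal-parks j₀ xⱼ₀≡1 = Equivalence.from (IsParkingFunction⇔ (removeAt x j₀))
    (All-removeAt x j₀ positive , λ {j} j<len →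
      ≤-pred (subst (2 + j ≤_) (count≤-removeAt-1 j x j₀ xⱼ₀≡1)
                    (counts (subst (j <_) (length-removeAt-pred x j₀ |x|≡2+k) j<len))))

PrimeCounts⇒All≤ : ∀ k x → length x ≡ suc (suc k) → PrimeCounts (suc k) x → All (_≤ suc k) x
PrimeCounts⇒All≤ k x |x|≡2+k counts =
  length≤count≤⇒All≤ (suc k) x (subst (_≤ count≤ (suc k) x) (sym |x|≡2+k) (counts ≤-refl))

IsPrimeParkingFunction⇔PrimeCounts : ∀ k x → length x ≡ suc (suc k) → All (1 ≤_) x →
                                     IsPrimeParkingFunction x ⇔ PrimeCounts (suc k) x
IsPrimeParkingFunction⇔PrimeCounts k x |x|≡2+k positive = mk⇔
  (IsPrimeParkingFunction⇒PrimeCounts (suc k) x |x|≡2+k)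
  (PrimeCounts⇒IsPrimeParkingFunction k x |x|≡2+k positive)

-- The cyclic lemma

+ʳ-≤-⇔ : ∀ d {a b a′ b′} → a + d ≡ a′ → b + d ≡ b′ → a ≤ b ⇔ a′ ≤ b′
+ʳ-≤-⇔ d refl refl = mk⇔ (+-monoˡ-≤ d) (+-cancelʳ-≤ d _ _)

𝟙-rotate : ∀ {m c k v} → c + k ≤ m → 1 ≤ v → 𝟙 (rotate m c v ≤? k) + 𝟙 (v ≤? c) ≡ 𝟙 (v ≤? c + k)
𝟙-rotate {m} {c} {k} {v} c+k≤m 1≤v with v ≤? c
... | no  v≰c = trans (+-identityʳ _) (𝟙-cong (rotate m c v ≤? k) (v ≤? c + k)
                        (+ʳ-≤-⇔ c (rotate-+-> m (≰⇒> v≰c)) (+-comm k c)))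
... | yes v≤c = trans (cong (_+ 1) (𝟙-no (rotate m c v ≤? k) rotated≰k))
                      (sym (𝟙-yes (v ≤? c + k) (≤-trans v≤c (m≤m+n c k))))
  where
  rotated≰k : ¬ rotate m c v ≤ k
  rotated≰k rot≤k = <⇒≱ (m<n+m m 1≤v) (begin
    v + m                ≡⟨ rotate-+-≤ (≤-trans (m≤m+n c k) c+k≤m) v≤c ⟨
    rotate m c v + c     ≤⟨ +-monoˡ-≤ c rot≤k ⟩
    k + c                ≡⟨ +-comm k c ⟩
    c + k                ≤⟨ c+k≤m ⟩
    m                    ∎)
    where open ≤-Reasoning

𝟙-rotate-wrap : ∀ {m c k t v} → c + k ≡ m + t → k ≤ m → c ≤ m → v ≤ m →
                𝟙 (rotate m c v ≤? k) + 𝟙 (v ≤? c) ≡ 1 + 𝟙 (v ≤? t)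
𝟙-rotate-wrap {m} {c} {k} {t} {v} c+k≡m+t k≤m c≤m v≤m with v ≤? c
... | no  v≰c = begin
  𝟙 (rotate m c v ≤? k) + 0   ≡⟨ +-identityʳ _ ⟩
  𝟙 (rotate m c v ≤? k)       ≡⟨ 𝟙-yes (rotate m c v ≤? k) rotated≤k ⟩
  1                           ≡⟨ cong suc (𝟙-no (v ≤? t) (<⇒≱ (≤-<-trans t≤c (≰⇒> v≰c)))) ⟨
  1 + 𝟙 (v ≤? t)              ∎
  where
  open ≡-Reasoning
  rotated≤k : rotate m c v ≤ k
  rotated≤k = Equivalence.from (+ʳ-≤-⇔ c (rotate-+-> m (≰⇒> v≰c)) (trans (+-comm k c) c+k≡m+t))
                               (≤-trans v≤m (m≤m+n m t))
  t≤c : t ≤ c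
  t≤c = +-cancelˡ-≤ m t c (subst (_≤ m + c) c+k≡m+t (subst (c + k ≤_) (+-comm c m) (+-monoʳ-≤ c k≤m)))
... | yes v≤c = trans (cong (_+ 1) (𝟙-cong (rotate m c v ≤? k) (v ≤? t) rotated≤k⇔v≤t)) (+-comm _ 1)
  where
  rotated≤k⇔v≤t : rotate m c v ≤ k ⇔ v ≤ t
  rotated≤k⇔v≤t = ⇔-sym (+ʳ-≤-⇔ m refl (+-comm t m))
                  ⇔-∘ +ʳ-≤-⇔ c (rotate-+-≤ c≤m v≤c) (trans (+-comm k c) c+k≡m+t)

count≤-rotate : ∀ {m c k} xs → c + k ≤ m → All (_∈[1, m ]) xs →
                count≤ k (map (rotate m c) xs) + count≤ c xs ≡ count≤ (c + k) xs
count≤-rotate []       _     _                 = refl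
count≤-rotate {m} {c} {k} (v ∷ xs) c+k≤m ((1≤v , _) ∷ xs∈) =
  trans (interchange (𝟙 (rotate m c v ≤? k)) (count≤ k (map (rotate m c) xs)) (𝟙 (v ≤? c)) (count≤ c xs))
        (cong₂ _+_ (𝟙-rotate c+k≤m 1≤v) (count≤-rotate xs c+k≤m xs∈))

count≤-rotate-wrap : ∀ {m c k t} xs → c + k ≡ m + t → k ≤ m → c ≤ m → All (_∈[1, m ]) xs →
                     count≤ k (map (rotate m c) xs) + count≤ c xs ≡ length xs + count≤ t xs
count≤-rotate-wrap []       _ _ _ _ = refl
count≤-rotate-wrap {m} {c} {k} {t} (v ∷ xs) c+k≡m+t k≤m c≤m ((_ , v≤m) ∷ xs∈) =
  trans (interchange (𝟙 (rotate m c v ≤? k)) (count≤ k (map (rotate m c) xs)) (𝟙 (v ≤? c)) (count≤ c xs))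
  (trans (cong₂ _+_ (𝟙-rotate-wrap c+k≡m+t k≤m c≤m v≤m) (count≤-rotate-wrap xs c+k≡m+t k≤m c≤m xs∈))
         (interchange 1 (𝟙 (v ≤? t)) (length xs) (count≤ t xs)))

LastMinimumAt : (ℕ → ℕ) → ℕ → ℕ → Set
LastMinimumAt f m c = (∀ {t} → t < c → f c ≤ f t) × (∀ {t} → c < t → t < m → f c < f t)

lastMinimum : ∀ f M → ∃[ c ] c ≤ M × LastMinimumAt f (suc M) c
lastMinimum f zero = 0 , z≤n , (λ ()) , (λ 0<t t<1 → ⊥-elim (<⇒≱ 0<t (≤-pred t<1)))
lastMinimum f (suc M) with lastMinimum f M
... | c , c≤M , below , above with f (suc M) ≤? f c
...   | yes fM≤fc = suc M , ≤-refl , below′ , (λ M<t t<2+M → ⊥-elim (<⇒≱ M<t (≤-pred t<2+M)))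
  where
  below′ : ∀ {t} → t < suc M → f (suc M) ≤ f t
  below′ {t} t≤M with <-cmp t c
  ... | tri< t<c _ _ = ≤-trans fM≤fc (below t<c)
  ... | tri≈ _ refl _ = fM≤fc
  ... | tri> _ _ c<t = ≤-trans fM≤fc (<⇒≤ (above c<t t≤M))
...   | no  fM≰fc = c , m≤n⇒m≤1+n c≤M , below , above′
  where
  above′ : ∀ {t} → c < t → t < suc (suc M) → f c < f t
  above′ c<t t<2+M with m<1+n⇒m<n∨m≡n t<2+M
  ... | inj₁ t≤M = above c<t t≤M
  ... | inj₂ refl = ≰⇒> fM≰fc

lastMinimum-unique : ∀ f {m c c′} → c < m → c′ < m → LastMinimumAt f m c → LastMinimumAt f m c′ → c ≡ c′
lastMinimum-unique f {c = c} {c′} c<m c′<m (below , above) (below′ , above′) with <-cmp c c′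
... | tri< c<c′ _ _ = ⊥-elim (<⇒≱ (above c<c′ c′<m) (below′ c<c′))
... | tri≈ _ c≡c′ _ = c≡c′
... | tri> _ _ c′<c = ⊥-elim (<⇒≱ (above′ c′<c c<m) (below c′<c))

-- #{i : xᵢ ≤ t} − t, shifted up by m so that it stays in ℕ for t ≤ m.
excess : ℕ → List ℕ → ℕ → ℕ
excess m x t = count≤ t x + (m ∸ t)

excess-≤⇔ : ∀ {m} x {c t} δ → c ≤ m → t ≤ m →
            δ + excess m x c ≤ excess m x t ⇔ δ + count≤ c x + t ≤ count≤ t x + c
excess-≤⇔ {m} x {c} {t} δ c≤m t≤m = ⇔-sym (+ʳ-≤-⇔ m refl refl) ⇔-∘ +ʳ-≤-⇔ (c + t) shift-c shift-t
  where
  open ≡-Reasoning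
  shift-c : δ + excess m x c + (c + t) ≡ δ + count≤ c x + t + m
  shift-c = begin
    δ + (count≤ c x + (m ∸ c)) + (c + t)  ≡⟨ regroup δ (count≤ c x) (m ∸ c) c t ⟩
    δ + count≤ c x + t + (m ∸ c + c)      ≡⟨ cong (δ + count≤ c x + t +_) (m∸n+n≡m c≤m) ⟩
    δ + count≤ c x + t + m                ∎
    where
    regroup : ∀ δ g a c t → δ + (g + a) + (c + t) ≡ δ + g + t + (a + c)
    regroup = solve-∀
  shift-t : excess m x t + (c + t) ≡ count≤ t x + c + m
  shift-t = begin
    count≤ t x + (m ∸ t) + (c + t)  ≡⟨ regroup (count≤ t x) (m ∸ t) c t ⟩
    count≤ t x + c + (m ∸ t + t)    ≡⟨ cong (count≤ t x + c +_) (m∸n+n≡m t≤m) ⟩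
    count≤ t x + c + m              ∎
    where
    regroup : ∀ g a c t → g + a + (c + t) ≡ g + c + (a + t)
    regroup = solve-∀

rotated-count-below⇔ : ∀ {m c k t} x → All (_∈[1, m ]) x → c + k ≡ t → t ≤ m →
                       suc k ≤ count≤ k (map (rotate m c) x) ⇔ excess m x c < excess m x t
rotated-count-below⇔ {m} {c} {k} {t} x x∈ c+k≡t t≤m =
  ⇔-sym (excess-≤⇔ x 1 c≤m t≤m) ⇔-∘ +ʳ-≤-⇔ (count≤ c x + c) shift-k shift-count
  where
  c+k≤m : c + k ≤ m
  c+k≤m = subst (_≤ m) (sym c+k≡t) t≤m
  c≤m : c ≤ m
  c≤m = ≤-trans (m≤m+n c k) c+k≤m
  shift-k : suc k + (count≤ c x + c) ≡ 1 + count≤ c x + t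
  shift-k = trans (regroup k (count≤ c x) c) (cong (λ s → suc (count≤ c x + s)) c+k≡t)
    where
    regroup : ∀ k g c → suc k + (g + c) ≡ suc (g + (c + k))
    regroup = solve-∀
  shift-count : count≤ k (map (rotate m c) x) + (count≤ c x + c) ≡ count≤ t x + c
  shift-count = trans (sym (+-assoc _ (count≤ c x) c))
                      (cong (_+ c) (trans (count≤-rotate x c+k≤m x∈) (cong (λ s → count≤ s x) c+k≡t)))

rotated-count-wrap⇔ : ∀ {m c k t} x → length x ≡ suc m → All (_∈[1, m ]) x →
                      c + k ≡ m + t → k ≤ m → c ≤ m → t ≤ m →
                      suc k ≤ count≤ k (map (rotate m c) x) ⇔ excess m x c ≤ excess m x t
rotated-count-wrap⇔ {m} {c} {k} {t} x |x|≡1+m x∈ c+k≡m+t k≤m c≤m t≤m =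
  ⇔-sym (excess-≤⇔ x 0 c≤m t≤m) ⇔-∘ (⇔-sym (+ʳ-≤-⇔ (suc m) refl refl)
                                      ⇔-∘ +ʳ-≤-⇔ (count≤ c x + c) shift-k shift-count)
  where
  open ≡-Reasoning
  shift-k : suc k + (count≤ c x + c) ≡ count≤ c x + t + suc m
  shift-k = begin
    suc k + (count≤ c x + c)    ≡⟨ regroup k (count≤ c x) c ⟩
    count≤ c x + suc (c + k)    ≡⟨ cong (λ s → count≤ c x + suc s) c+k≡m+t ⟩
    count≤ c x + suc (m + t)    ≡⟨ regroup′ (count≤ c x) m t ⟩
    count≤ c x + t + suc m      ∎
    where
    regroup : ∀ k g c → suc k + (g + c) ≡ g + suc (c + k)
    regroup = solve-∀
    regroup′ : ∀ g m t → g + suc (m + t) ≡ g + t + suc m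
    regroup′ = solve-∀
  shift-count : count≤ k (map (rotate m c) x) + (count≤ c x + c) ≡ count≤ t x + c + suc m
  shift-count = begin
    count≤ k (map (rotate m c) x) + (count≤ c x + c)    ≡⟨ +-assoc _ (count≤ c x) c ⟨
    count≤ k (map (rotate m c) x) + count≤ c x + c      ≡⟨ cong (_+ c) (count≤-rotate-wrap x c+k≡m+t k≤m c≤m x∈) ⟩
    length x + count≤ t x + c                           ≡⟨ cong (λ n → n + count≤ t x + c) |x|≡1+m ⟩
    suc m + count≤ t x + c                              ≡⟨ regroup m (count≤ t x) c ⟩
    count≤ t x + c + suc m                              ∎
    where
    regroup : ∀ m g c → suc m + g + c ≡ g + c + suc m
    regroup = solve-∀

PrimeCounts-at : ∀ {m k} y → PrimeCounts m y → 1 ≤ k → k ≤ m → suc k ≤ count≤ k y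
PrimeCounts-at {k = suc j} y prime _ k≤m = prime k≤m

PrimeCounts-rotate⇒LastMinimumAt : ∀ {m c} x → length x ≡ suc m → All (_∈[1, m ]) x → c < m →
                                   PrimeCounts m (map (rotate m c) x) → LastMinimumAt (excess m x) m c
PrimeCounts-rotate⇒LastMinimumAt {m} {c} x |x|≡1+m x∈ c<m prime = below , above
  where
  c≤m : c ≤ m
  c≤m = <⇒≤ c<m
  below : ∀ {t} → t < c → excess m x c ≤ excess m x t
  below {t} t<c = Equivalence.to (rotated-count-wrap⇔ x |x|≡1+m x∈ c+k≡m+t k≤m c≤m t≤m)
                                 (PrimeCounts-at (map (rotate m c) x) prime 1≤k k≤m)
    where
    k = m ∸ c + t
    t≤m : t ≤ m
    t≤m = ≤-trans (<⇒≤ t<c) c≤m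
    c+k≡m+t : c + k ≡ m + t
    c+k≡m+t = trans (sym (+-assoc c (m ∸ c) t)) (cong (_+ t) (m+[n∸m]≡n c≤m))
    1≤k : 1 ≤ k
    1≤k = ≤-trans (m<n⇒0<n∸m c<m) (m≤m+n (m ∸ c) t)
    k≤m : k ≤ m
    k≤m = ≤-trans (+-monoʳ-≤ (m ∸ c) (<⇒≤ t<c)) (≤-reflexive (m∸n+n≡m c≤m))
  above : ∀ {t} → c < t → t < m → excess m x c < excess m x t
  above {t} c<t t<m = Equivalence.to (rotated-count-below⇔ x x∈ (m+[n∸m]≡n (<⇒≤ c<t)) (<⇒≤ t<m))
                                     (PrimeCounts-at (map (rotate m c) x) prime (m<n⇒0<n∸m c<t)
                                                     (≤-trans (m∸n≤m t c) (<⇒≤ t<m)))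

LastMinimumAt⇒PrimeCounts-rotate : ∀ {m c} x → length x ≡ suc m → All (_∈[1, m ]) x → c < m →
                                   LastMinimumAt (excess m x) m c → PrimeCounts m (map (rotate m c) x)
LastMinimumAt⇒PrimeCounts-rotate {m} {c} x |x|≡1+m x∈ c<m (below , above) {j} j<m with c + suc j <? m
... | yes c+k<m = Equivalence.from (rotated-count-below⇔ x x∈ refl (<⇒≤ c+k<m)) (above (m<m+n c (s≤s z≤n)) c+k<m)
... | no  c+k≮m = Equivalence.from (rotated-count-wrap⇔ x |x|≡1+m x∈ c+k≡m+t j<m c≤m t≤m) excess-c≤t
  where
  c≤m : c ≤ m
  c≤m = <⇒≤ c<m
  t = c + suc j ∸ m
  c+k≡m+t : c + suc j ≡ m + t
  c+k≡m+t = sym (m+[n∸m]≡n (≮⇒≥ c+k≮m))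
  t≤c : t ≤ c
  t≤c = +-cancelˡ-≤ m t c (begin
    m + t        ≡⟨ c+k≡m+t ⟨
    c + suc j    ≤⟨ +-monoʳ-≤ c j<m ⟩
    c + m        ≡⟨ +-comm c m ⟩
    m + c        ∎)
    where open ≤-Reasoning
  t≤m : t ≤ m
  t≤m = ≤-trans t≤c c≤m
  excess-c≤t : excess m x c ≤ excess m x t
  excess-c≤t with m≤n⇒m<n∨m≡n t≤c
  ... | inj₁ t<c = below t<c
  ... | inj₂ t≡c = ≤-reflexive (cong (excess m x) (sym t≡c))

∑-𝟙-PrimeCounts-rotate : ∀ k x → length x ≡ suc (suc k) → All (_∈[1, suc k ]) x →
                         ∑[ c < suc k ] 𝟙 (primeCounts? (suc k) (map (rotate (suc k) c) x)) ≡ 1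
∑-𝟙-PrimeCounts-rotate k x |x|≡2+k x∈ =
  let c₀ , c₀≤k , c₀-last = lastMinimum (excess (suc k) x) k
  in ∑-𝟙-unique (suc k) (λ c → primeCounts? (suc k) (map (rotate (suc k) c) x)) (s≤s c₀≤k)
       (LastMinimumAt⇒PrimeCounts-rotate x |x|≡2+k x∈ (s≤s c₀≤k) c₀-last)
       (λ c<m prime → lastMinimum-unique (excess (suc k) x) c<m (s≤s c₀≤k)
                        (PrimeCounts-rotate⇒LastMinimumAt x |x|≡2+k x∈ c<m prime) c₀-last)

ppfSum≡∑tuples-PrimeCounts : ∀ k ℓ q → ppfSum (2 + k) ℓ q ≡
  ∑tuples (2 + k) (suc k) (λ x → 𝟙 (primeCounts? (suc k) x) * q ^ countForwardDiff (suc k) ℓ x)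
ppfSum≡∑tuples-PrimeCounts k ℓ q = begin
  sum (map w (filter isPrimeParkingFunction? (tuples n n)))
    ≡⟨ sum-map-filter isPrimeParkingFunction? w (tuples n n) ⟩
  sum (map (λ x → 𝟙 (isPrimeParkingFunction? x) * w x) (tuples n n))
    ≡⟨ sum-map-tuples n n _ ⟩
  ∑tuples n n (λ x → 𝟙 (isPrimeParkingFunction? x) * w x)
    ≡⟨ ∑tuples-cong n n (λ {x} |x|≡n x∈ → cong (_* w x) (𝟙-cong (isPrimeParkingFunction? x) (primeCounts? m x)
                                 (IsPrimeParkingFunction⇔PrimeCounts k x |x|≡n (All.map proj₁ x∈)))) ⟩
  ∑tuples n n (λ x → 𝟙 (primeCounts? m x) * w x)
    ≡⟨ ∑tuples-truncate n _ (n≤1+n m) (λ {x} |x|≡n large → cong (_* w x)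
         (𝟙-no (primeCounts? m x) (λ prime →
            All¬⇒¬Any (All.map ≤⇒≯ (PrimeCounts⇒All≤ k x |x|≡n prime)) large))) ⟩
  ∑tuples n m (λ x → 𝟙 (primeCounts? m x) * w x) ∎
  where
  open ≡-Reasoning
  n = 2 + k
  m = suc k
  w : List ℕ → ℕ
  w x = q ^ countForwardDiff m ℓ x

∑tuples-cyclic : ∀ k ℓ q →
  ∑tuples (2 + k) (suc k) (λ x → q ^ countForwardDiff (suc k) ℓ x) ≡
  suc k * ∑tuples (2 + k) (suc k) (λ x → 𝟙 (primeCounts? (suc k) x) * q ^ countForwardDiff (suc k) ℓ x)
∑tuples-cyclic k ℓ q = begin
  ∑tuples n m w
    ≡⟨ ∑tuples-cong n m (λ {x} |x|≡n x∈ → orbit x |x|≡n x∈) ⟩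
  ∑tuples n m (λ x → ∑[ c < m ] (𝟙 (primeCounts? m (map (rotate m c) x)) * w x))
    ≡⟨ ∑tuples-∑ n m m (λ c x → 𝟙 (primeCounts? m (map (rotate m c) x)) * w x) ⟩
  ∑[ c < m ] ∑tuples n m (λ x → 𝟙 (primeCounts? m (map (rotate m c) x)) * w x)
    ≡⟨ ∑-cong m (λ {c} c<m → ∑tuples-cong n m (λ {x} _ _ →
         cong (λ d → 𝟙 (primeCounts? m (map (rotate m c) x)) * q ^ d)
              (sym (countForwardDiff-rotate {ℓ = ℓ} x (<⇒≤ c<m))))) ⟩
  ∑[ c < m ] ∑tuples n m (F ∘ map (rotate m c))
    ≡⟨ ∑-cong m (λ c<m → ∑tuples-rotate n F (<⇒≤ c<m)) ⟩
  ∑[ c < m ] ∑tuples n m F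
    ≡⟨ ∑-const m _ ⟩
  m * ∑tuples n m F ∎
  where
  open ≡-Reasoning
  n = 2 + k
  m = suc k
  w F : List ℕ → ℕ
  w x = q ^ countForwardDiff m ℓ x
  F x = 𝟙 (primeCounts? m x) * w x
  orbit : ∀ x → length x ≡ n → All (_∈[1, m ]) x → w x ≡ ∑[ c < m ] (𝟙 (primeCounts? m (map (rotate m c) x)) * w x)
  orbit x |x|≡n x∈ = begin
    w x                                                      ≡⟨ *-identityˡ (w x) ⟨
    1 * w x                                                  ≡⟨ cong (_* w x) (∑-𝟙-PrimeCounts-rotate k x |x|≡n x∈) ⟨
    ∑[ c < m ] 𝟙 (primeCounts? m (map (rotate m c) x)) * w x  ≡⟨ *-distribʳ-∑ m (w x) _ ⟩
    ∑[ c < m ] (𝟙 (primeCounts? m (map (rotate m c) x)) * w x) ∎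

proposition1p5 : (n ℓ : ℕ) → 2 ≤ n → ℓ ≤ n ∸ 2 →
    (q : ℕ) → ppfSum n ℓ q ≡ (q + (n ∸ 2)) ^ (n ∸ 1)
proposition1p5 1 _ (s≤s ()) _ _
proposition1p5 (suc (suc k)) ℓ _ ℓ≤k q = *-cancelˡ-≡ _ _ (suc k) (begin
  suc k * ppfSum (2 + k) ℓ q
    ≡⟨ cong (suc k *_) (ppfSum≡∑tuples-PrimeCounts k ℓ q) ⟩
  suc k * ∑tuples (2 + k) (suc k) (λ x → 𝟙 (primeCounts? (suc k) x) * q ^ countForwardDiff (suc k) ℓ x)
    ≡⟨ ∑tuples-cyclic k ℓ q ⟨
  ∑tuples (2 + k) (suc k) (λ x → q ^ countForwardDiff (suc k) ℓ x)
    ≡⟨ ∑tuples-pow-countForwardDiff q k (suc k) ℓ≤k ⟩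
  suc k * (q + k) ^ suc k ∎)
  where open ≡-Reasoning
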